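{- In ${\cal TML}$ both directions of the deduction metatheorem with respect to $\succ$ fail when more than one premise is allowed: (i) there exist formulas $\alpha,\beta,\gamma$ with $\alpha,\beta\models\gamma$ but $\alpha\not\models\beta\succ\gamma$; (ii) there exist formulas $\alpha,\beta,\gamma$ with $\alpha\models\beta\succ\gamma$ but $\alpha,\beta\not\models\gamma$.
   Context: Let $M_4=\{\mathbf 0,\mathbf n,\mathbf b,\mathbf 1\}$ be the lattice with $\mathbf 0<\mathbf n,\mathbf b<\mathbf 1$, $\mathbf n,\mathbf b$ incomparable. $\mathfrak M_{4m}$ is this lattice with $\neg\mathbf 0=\mathbf 1$, $\neg\mathbf 1=\mathbf 0$, $\neg\mathbf n=\mathbf n$, $\neg\mathbf b=\mathbf b$, $\square\mathbf 1=\mathbf 1$, $\square x=\mathbf 0$ otherwise; it generates the variety of tetravalent modal algebras. The contrapositive implication $x\succ y=(\neg\square x\vee y)\wedge(\neg\square\neg y\vee\neg x)\wedge(\neg\square(\neg x\vee y)\vee(\square\neg x\vee y))$ has in $\mathfrak M_{4m}$ the table: $\mathbf 0\succ y=\mathbf 1$; $\mathbf n\succ\mathbf 0=\mathbf n$, $\mathbf n\succ\mathbf n=\mathbf 1$, $\mathbf n\succ\mathbf b=\mathbf b$, $\mathbf n\succ\mathbf 1=\mathbf 1$; $\mathbf b\succ\mathbf 0=\mathbf b$, $\mathbf b\succ\mathbf n=\mathbf n$, $\mathbf b\succ\mathbf b=\mathbf 1$, $\mathbf b\succ\mathbf 1=\mathbf 1$; $\mathbf 1\succ y=y$. Formulas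 are built from propositional variables and $\bot$ with $\wedge,\vee,\neg,\square$ (and $\succ$ as abbreviation). A valuation is a homomorphism $h$ from formulas to $\mathfrak M_{4m}$ with $h(\bot)=\mathbf 0$. For a finite set $\Gamma$ of formulas, $\Gamma\models\gamma$ means $\bigwedge\{h(\delta):\delta\in\Gamma\}\le h(\gamma)$ for every valuation $h$ (with $\bigwedge\emptyset=\mathbf 1$). -}

module Defs where

open import Data.Nat using (ℕ)
open import Data.List using (List; []; _∷_; foldr)

data M4 : Set where
  𝟎 𝐧 𝐛 𝟏 : M4

data _≤₄_ : M4 → M4 → Set where
  0≤ : ∀ {x} → 𝟎 ≤₄ x
  ≤1 : ∀ {x} → x ≤₄ 𝟏
  n≤n : 𝐧 ≤₄ 𝐧
  b≤b : 𝐛 ≤₄ 𝐛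

_∧₄_ : M4 → M4 → M4
𝟎 ∧₄ y = 𝟎
𝟏 ∧₄ y = y
𝐧 ∧₄ 𝟎 = 𝟎
𝐧 ∧₄ 𝐧 = 𝐧
𝐧 ∧₄ 𝐛 = 𝟎
𝐧 ∧₄ 𝟏 = 𝐧
𝐛 ∧₄ 𝟎 = 𝟎
𝐛 ∧₄ 𝐧 = 𝟎
𝐛 ∧₄ 𝐛 = 𝐛
𝐛 ∧₄ 𝟏 = 𝐛

_∨₄_ : M4 → M4 → M4
𝟎 ∨₄ y = y
𝟏 ∨₄ y = 𝟏
𝐧 ∨₄ 𝟎 = 𝐧
𝐧 ∨₄ 𝐧 = 𝐧
𝐧 ∨₄ 𝐛 = 𝟏
𝐧 ∨₄ 𝟏 = 𝟏
𝐛 ∨₄ 𝟎 = 𝐛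
𝐛 ∨₄ 𝐧 = 𝟏
𝐛 ∨₄ 𝐛 = 𝐛
𝐛 ∨₄ 𝟏 = 𝟏

¬₄_ : M4 → M4
¬₄ 𝟎 = 𝟏
¬₄ 𝐧 = 𝐧
¬₄ 𝐛 = 𝐛
¬₄ 𝟏 = 𝟎

□₄_ : M4 → M4
□₄ 𝟏 = 𝟏
□₄ 𝟎 = 𝟎
□₄ 𝐧 = 𝟎
□₄ 𝐛 = 𝟎

data Formula : Set where
  var : ℕ → Formula
  ⊥f  : Formula
  _∧f_ _∨f_ : Formula → Formula → Formula
  ¬f_ □f_ : Formula → Formula

_≻_ : Formula → Formula → Formula
x ≻ y = ((¬f (□f x)) ∨f y)
        ∧f (((¬f (□f (¬f y))) ∨f (¬f x))
        ∧f ((¬f (□f ((¬f x) ∨f y))) ∨f ((□f (¬f x)) ∨f y)))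

-- valuations: homomorphisms into 𝔐_{4m} with h(⊥) = 𝟎, determined by
-- their values on variables
eval : (ℕ → M4) → Formula → M4
eval v (var i) = v i
eval v ⊥f = 𝟎
eval v (φ ∧f ψ) = eval v φ ∧₄ eval v ψ
eval v (φ ∨f ψ) = eval v φ ∨₄ eval v ψ
eval v (¬f φ) = ¬₄ eval v φ
eval v (□f φ) = □₄ eval v φ

_⊨_ : List Formula → Formula → Set
Γ ⊨ γ = ∀ (v : ℕ → M4) → foldr (λ δ acc → eval v δ ∧₄ acc) 𝟏 Γ ≤₄ eval v γ

module Submission where

open import Defs
open import Data.List using (_∷_; [])
open import Data.Nat using (ℕ)
open import Data.Product using (Σ-syntax; _×_; _,_)
open import Relation.Nullary using (¬_)
open import Relation.Binary.PropositionalEquality using (_≡_; refl)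

-- Several premises are combined by the lattice meet, whereas δ ≻ γ sees δ
-- only through □, which sends both 𝐧 and 𝐛 to 𝟎.
-- (i) Under p ↦ 𝐧, q ↦ 𝐛 the premises p, q meet to 𝟎, so p, q ⊨ p ∧ q, but
-- q ≻ (p ∧ q) = 𝐛 ≻ 𝟎 = 𝐛 is not above p = 𝐧.
-- (ii) p ⊨ p ≻ □p because x ≻ 𝟎 = x for x ∈ {𝐧, 𝐛}, yet under p ↦ 𝐧 the
-- premises p, p give 𝐧 while □p is 𝟎.

-- The value of ≻ in 𝔐_{4m}: eval v (φ ≻ ψ) reduces to eval v φ ≻₄ eval v ψ.
_≻₄_ : M4 → M4 → M4
x ≻₄ y = ((¬₄ (□₄ x)) ∨₄ y)
         ∧₄ (((¬₄ (□₄ (¬₄ y))) ∨₄ (¬₄ x))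
         ∧₄ ((¬₄ (□₄ ((¬₄ x) ∨₄ y))) ∨₄ ((□₄ (¬₄ x)) ∨₄ y)))

≤₄-refl : ∀ {x} → x ≤₄ x
≤₄-refl {𝟎} = 0≤
≤₄-refl {𝐧} = n≤n
≤₄-refl {𝐛} = b≤b
≤₄-refl {𝟏} = ≤1

∧₄-identityʳ : ∀ x → (x ∧₄ 𝟏) ≡ x
∧₄-identityʳ 𝟎 = refl
∧₄-identityʳ 𝐧 = refl
∧₄-identityʳ 𝐛 = refl
∧₄-identityʳ 𝟏 = refl

≤₄-≻₄-□₄ : ∀ x → x ≤₄ (x ≻₄ (□₄ x))
≤₄-≻₄-□₄ 𝟎 = 0≤
≤₄-≻₄-□₄ 𝐧 = n≤n
≤₄-≻₄-□₄ 𝐛 = b≤b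
≤₄-≻₄-□₄ 𝟏 = ≤1

⊨-∧-intro : ∀ φ ψ → (φ ∷ ψ ∷ []) ⊨ (φ ∧f ψ)
⊨-∧-intro φ ψ v rewrite ∧₄-identityʳ (eval v ψ) = ≤₄-refl

⊨-≻-□ : ∀ φ → (φ ∷ []) ⊨ (φ ≻ (□f φ))
⊨-≻-□ φ v rewrite ∧₄-identityʳ (eval v φ) = ≤₄-≻₄-□₄ (eval v φ)

p q : Formula
p = var 0
q = var 1

p↦𝐧,q↦𝐛 : ℕ → M4
p↦𝐧,q↦𝐛 0 = 𝐧
p↦𝐧,q↦𝐛 _ = 𝐛

⊭-≻-∧ : ¬ ((p ∷ []) ⊨ (q ≻ (p ∧f q)))
⊭-≻-∧ entails with entails p↦𝐧,q↦𝐛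
... | ()

⊭-□ : ¬ ((p ∷ p ∷ []) ⊨ (□f p))
⊭-□ entails with entails (λ _ → 𝐧)
... | ()

proposition4p9 : (Σ[ α ∈ Formula ] Σ[ β ∈ Formula ] Σ[ γ ∈ Formula ]
    ((α ∷ β ∷ []) ⊨ γ) × (¬ ((α ∷ []) ⊨ (β ≻ γ))))
    × (Σ[ α ∈ Formula ] Σ[ β ∈ Formula ] Σ[ γ ∈ Formula ]
    ((α ∷ []) ⊨ (β ≻ γ)) × (¬ ((α ∷ β ∷ []) ⊨ γ)))
proposition4p9 =
    (p , q , (p ∧f q) , ⊨-∧-intro p q , ⊭-≻-∧)
  , (p , p , (□f p) , ⊨-≻-□ p , ⊭-□)
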